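{- Let $n\ge3$ and $\Sigma=\{0,1\}$. Let $S_n^2=\{w_1,\ldots,w_N\}$ be the set $S_{n,2}^{(k)}$ for a value $k\in\{1,\ldots,n-2\}$ maximizing $|S_{n,2}^{(k)}|$ (for $n=4$, where $k=1$ and $k=2$ both give cardinality $1$, take $k=1$, i.e. $S_4^2=\{1000\}$). Let $CBBF_n^2$ be the set of all $n\times n$ binary matrices $C$ whose main diagonal $C[1,1]C[2,2]\cdots C[n,n]$ is a word of $S_n^2$ and whose off-diagonal entries are arbitrary elements of $\{0,1\}$. Then $CBBF_n^2$ is a non-expandable cross-bibifix-free set on $BBF_n^2$.
   Context: For $n\ge3$ and $1\le k\le n-2$, $S_{n,2}^{(k)}$ is the set of binary words $s[1]s[2]\cdots s[n]$ such that $s[1]=\cdots=s[k]=1$, $s[k+1]=0$, $s[n]=0$, and the sub-word $s[k+2]\cdots s[n-1]$ does not contain $k$ consecutive $1$s. For an $m\times m$ matrix $T$ and $1\le r<m$, the $r\times r$ biprefix of $T$ is $T[1\ldots r,1\ldots r]$ and the $r\times r$ bisuffix is $T[m-r+1\ldots m,\,m-r+1\ldots m]$; $T$ is bibifix-free if for no $1\le r<m$ its $r\times r$ biprefix equals its $r\times r$ bisuffix. $BBF_n^2$ is the set of all $n\times n$ bibifix-free binary matrices. Two distinct $T,T'\in BBF_n^2$ are cross-bibifix-free if no biprefix of $T$ equals a bisuffix (of the same dimension) of $T'$ and no biprefix of $T'$ equals a bisuffix of $T$. A subset of $BBF_n^2$ is a cross-bibifix-free set if any two distinct elements of it are cross-bibifix-free;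 it is non-expandable on $BBF_n^2$ if adding any further matrix of $BBF_n^2$ yields a set that is not cross-bibifix-free. -}

module Defs where

open import Data.Nat using (ℕ; suc; _+_; _∸_; _≤_; _<_)
open import Data.Bool using (Bool; true; false)
open import Data.Fin using (Fin; toℕ)
open import Data.Vec using (Vec; lookup; tabulate)
open import Data.List using (List; length)
open import Data.List.Relation.Unary.Unique.Propositional using (Unique)
open import Data.List.Membership.Propositional using (_∈_)
open import Data.Product using (Σ; ∃; _×_)
open import Data.Sum using (_⊎_)
open import Relation.Nullary using (¬_)
open import Relation.Binary.PropositionalEquality using (_≡_)
open import Function.Bundles using (_⇔_)

-- Binary words of length n: Vec Bool n, position p (1-indexed in the paper)
-- is the Fin index p-1; true = 1, false = 0.
Word : ℕ → Set
Word n = Vec Bool n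

-- The sub-word s[k+2..n-1] (0-indexed positions k+1 .. n-2) contains k
-- consecutive 1s: some run starting at 0-indexed position j with
-- k+1 ≤ j and j+k-1 ≤ n-2 consists entirely of 1s.
HasRun : (n k : ℕ) → Word n → Set
HasRun n k w =
  Σ ℕ λ j → (suc k ≤ j) × (j + k ≤ n ∸ 1) ×
    (∀ (i : Fin n) → j ≤ toℕ i → toℕ i < j + k → lookup w i ≡ true)

InS : (n k : ℕ) → Word n → Set
InS n k w =
  (∀ (i : Fin n) → toℕ i < k → lookup w i ≡ true) ×
  (∀ (i : Fin n) → toℕ i ≡ k → lookup w i ≡ false) ×
  (∀ (i : Fin n) → suc (toℕ i) ≡ n → lookup w i ≡ false) ×
  ¬ HasRun n k w

HasCard : {n : ℕ} → (Word n → Set) → ℕ → Set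
HasCard {n} P N =
  Σ (List (Word n)) λ l → Unique l × (∀ w → (w ∈ l) ⇔ P w) × (length l ≡ N)

IsMaxK : (n k : ℕ) → Set
IsMaxK n k =
  ∀ k' N' N → 1 ≤ k' → k' ≤ n ∸ 2 →
    HasCard (InS n k') N' → HasCard (InS n k) N → N' ≤ N

-- n×n binary matrices, indices 0-based.
Mat : ℕ → Set
Mat n = Fin n → Fin n → Bool

PrefEqSuf : (n r : ℕ) → Mat n → Mat n → Set
PrefEqSuf n r T T' =
  ∀ (i j i' j' : Fin n) → toℕ i < r → toℕ j < r →
    toℕ i' ≡ toℕ i + (n ∸ r) → toℕ j' ≡ toℕ j + (n ∸ r) →
    T i j ≡ T' i' j'

BBF : (n : ℕ) → Mat n → Set
BBF n T = ∀ r → 1 ≤ r → r < n → ¬ PrefEqSuf n r T T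

CrossBBF : (n : ℕ) → Mat n → Mat n → Set
CrossBBF n T T' =
  ∀ r → 1 ≤ r → r < n → ¬ PrefEqSuf n r T T' × ¬ PrefEqSuf n r T' T

Distinct : {n : ℕ} → Mat n → Mat n → Set
Distinct T T' = ¬ (∀ i j → T i j ≡ T' i j)

CrossBBFSet : (n : ℕ) → (Mat n → Set) → Set
CrossBBFSet n P = ∀ T T' → P T → P T' → Distinct T T' → CrossBBF n T T'

CrossBBFSetOn : (n : ℕ) → (Mat n → Set) → Set
CrossBBFSetOn n P = (∀ T → P T → BBF n T) × CrossBBFSet n P

NonExpandable : (n : ℕ) → (Mat n → Set) → Set
NonExpandable n P =
  ∀ T → BBF n T → ¬ P T → ¬ CrossBBFSet n (λ X → P X ⊎ X ≡ T)

CBBF : (n k : ℕ) → Mat n → Set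
CBBF n k C = InS n k (tabulate (λ i → C i i))

module Submission where

-- Everything is decided by diagonals, read as functions ℕ → Bool (IsSk below is membership
-- in S_{n,2}^{(k)} for such a function, equivalent to the vector-based InS).
-- 1. Overlap freeness (S-overlap-free): a proper prefix of one word of S^{(k)} is never a
--    suffix of another.  A biprefix equal to a bisuffix restricts to the diagonals, so
--    CBBF is a cross-bibifix-free subset of BBF.
-- 2. Non-expandability, assuming 2k+1 ≤ n: every T ∈ BBF outside CBBF overlaps a member C
--    of CBBF.  If T's diagonal has a 0 at some a < k, C carries T's (a+1)×(a+1) corner at
--    its bottom right (corner-overlap); otherwise C is T shifted up-left by the largest
--    start j ≥ 1 of a block of k ones in its diagonal (leading-ones-overlap).
-- 3. Maximality gives 2k+1 ≤ n (maximal-k-bound): if n ≤ 2k with k ≥ 3, dropping the first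
--    letter injects S^{(k)} into S^{(k-1)} and misses 1^{k-1}0…010, so |S^{(k)}| < |S^{(k-1)}|
--    (k = 2 leaves only the excluded case n = 4).

open import Defs
open import Data.Nat using (ℕ; zero; suc; _+_; _∸_; _≤_; _<_; z≤n; s≤s; s≤s⁻¹; _<?_; _≤?_; _≟_)
open import Data.Nat.Properties
open import Data.Bool using (Bool; true; false; _∨_)
open import Data.Fin using (Fin; toℕ; fromℕ<)
open import Data.Fin.Properties using (toℕ<n; fromℕ<-toℕ; toℕ-fromℕ<; all?)
open import Data.Vec as Vec using (lookup; tabulate)
open import Data.Vec.Properties using (lookup∘tabulate; tabulate∘lookup; tabulate-cong; ∷-injectiveʳ)
open import Data.List using (List; []; _∷_; length; map; filter; _++_)
open import Data.List.Properties using (length-map; length-removeAt′)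
open import Data.List.Membership.Propositional using (_∈_)
open import Data.List.Membership.Propositional.Properties
  using (∈-map⁺; ∈-map⁻; ∈-++⁺ˡ; ∈-++⁺ʳ; ∈-filter⁺; ∈-filter⁻)
open import Data.List.Relation.Unary.Any using (here; there; index; _─_)
import Data.List.Relation.Unary.All as All
import Data.List.Relation.Unary.All.Properties as All
open import Data.List.Relation.Unary.Unique.Propositional using (Unique)
import Data.List.Relation.Unary.Unique.Propositional.Properties as Unique
open import Data.List.Relation.Unary.AllPairs using ([]; _∷_)
open import Function.Bundles using (mk⇔; Equivalence)
open import Data.Product using (Σ; _×_; _,_; proj₁; proj₂)
open import Data.Sum using (_⊎_; inj₁; inj₂)
open import Data.Empty using (⊥; ⊥-elim)
open import Relation.Nullary using (¬_; Dec; yes; no; does; contradiction)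
open import Relation.Nullary.Decidable using (dec-true; dec-false; map′; _×-dec_; _→-dec_; ¬?)
open import Data.Bool.Properties using (¬-not; ∨-zeroʳ) renaming (_≟_ to _≟ᵇ_)
open import Relation.Binary.PropositionalEquality
open import Function using (_∘_; case_of_)

-- Entry of a matrix at natural coordinates (outside the matrix: 0).  Working with
-- natural positions lets the combinatorics be done on functions ℕ → Bool.
entry : ∀ {n} → Mat n → ℕ → ℕ → Bool
entry {n} T x y with x <? n | y <? n
... | yes x<n | yes y<n = T (fromℕ< x<n) (fromℕ< y<n)
... | _ | _ = false

entry-< : ∀ {n} (T : Mat n) {x y} (x<n : x < n) (y<n : y < n) →
          entry T x y ≡ T (fromℕ< x<n) (fromℕ< y<n)
entry-< {n} T {x} {y} x<n y<n with x <? n | y <? n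
... | yes _ | yes _ = refl
... | no x≮n | _ = contradiction x<n x≮n
... | yes _ | no y≮n = contradiction y<n y≮n

entry-toℕ : ∀ {n} (T : Mat n) (i j : Fin n) → entry T (toℕ i) (toℕ j) ≡ T i j
entry-toℕ T i j = trans (entry-< T (toℕ<n i) (toℕ<n j))
                        (cong₂ T (fromℕ<-toℕ i (toℕ<n i)) (fromℕ<-toℕ j (toℕ<n j)))

entry-describes : ∀ {n} (T : Mat n) i j → T i j ≡ entry T (toℕ i) (toℕ j)
entry-describes T i j = sym (entry-toℕ T i j)

entry-≥ : ∀ {n} (T : Mat n) {x y} → n ≤ x → entry T x y ≡ false
entry-≥ {n} T {x} {y} n≤x with x <? n | y <? n
... | yes x<n | yes _ = contradiction x<n (≤⇒≯ n≤x)
... | yes _ | no _ = refl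
... | no _ | _ = refl

matOf : ∀ {n} → (ℕ → ℕ → Bool) → Mat n
matOf F i j = F (toℕ i) (toℕ j)

diagonal : ∀ {n} → Mat n → ℕ → Bool
diagonal T x = entry T x x

Block : ℕ → (ℕ → Bool) → ℕ → Set
Block k g j = ∀ t → t < k → g (j + t) ≡ true

Run : ℕ → ℕ → (ℕ → Bool) → Set
Run n k g = Σ ℕ λ j → suc k ≤ j × j + k ≤ n ∸ 1 × Block k g j

record IsSk (n k : ℕ) (g : ℕ → Bool) : Set where
  constructor mkS
  field
    leading : ∀ x → x < k → g x ≡ true
    at-k : g k ≡ false
    at-end : g (n ∸ 1) ≡ false
    no-run : ¬ Run n k g

record Describes {n} (w : Word n) (g : ℕ → Bool) : Set where
  constructor describes
  field letter : ∀ i → lookup w i ≡ g (toℕ i)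

describes-< : ∀ {n} {w : Word n} {g} → Describes w g → ∀ {x} (x<n : x < n) →
              g x ≡ lookup w (fromℕ< x<n)
describes-< {g = g} (describes D) x<n = trans (cong g (sym (toℕ-fromℕ< x<n))) (sym (D (fromℕ< x<n)))

n∸1<n : ∀ {n} → 1 ≤ n → n ∸ 1 < n
n∸1<n {suc n} _ = n<1+n n

suc-n∸1 : ∀ {n} → 1 ≤ n → suc (n ∸ 1) ≡ n
suc-n∸1 {suc n} _ = refl

-- The two descriptions of S_{n,2}^{(k)} agree on every word (the positions IsSk
-- mentions all lie below n).
InS-fromIsSk : ∀ {n k} {w : Word n} {g} → Describes w g → IsSk n k g → InS n k w
InS-fromIsSk {n} {k} {w} {g} Dw@(describes D) (mkS lead atk atn norun) =
  (λ i i<k → trans (D i) (lead (toℕ i) i<k)) ,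
  (λ i i≡k → trans (D i) (trans (cong g i≡k) atk)) ,
  (λ i i+1≡n → trans (D i) (trans (cong g (cong (_∸ 1) i+1≡n)) atn)) ,
  λ (j , k<j , j+k≤ , run) → norun (j , k<j , j+k≤ , λ t t<k →
    let x<n = <-≤-trans (+-monoʳ-< j t<k) (≤-trans j+k≤ (m∸n≤m n 1))
        i = fromℕ< x<n
        toℕi = toℕ-fromℕ< x<n
    in trans (describes-< Dw x<n)
         (run i (subst (j ≤_) (sym toℕi) (m≤m+n j t)) (subst (_< j + k) (sym toℕi) (+-monoʳ-< j t<k))))

IsSk-fromInS : ∀ {n k} {w : Word n} {g} → k < n → Describes w g → InS n k w → IsSk n k g
IsSk-fromInS {n} {k} {w} {g} k<n Dw@(describes D) (lead , atk , atn , norun) = mkS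
  (λ x x<k → let x<n = <-trans x<k k<n in
     trans (describes-< Dw x<n) (lead (fromℕ< x<n) (subst (_< k) (sym (toℕ-fromℕ< x<n)) x<k)))
  (trans (describes-< Dw k<n) (atk (fromℕ< k<n) (toℕ-fromℕ< k<n)))
  (trans (describes-< Dw n-1<n)
         (atn (fromℕ< n-1<n) (trans (cong suc (toℕ-fromℕ< n-1<n)) (suc-n∸1 1≤n))))
  λ (j , k<j , j+k≤ , blk) → norun (j , k<j , j+k≤ , λ i j≤i i<j+k →
    trans (D i) (subst (λ x → g x ≡ true) (m+[n∸m]≡n j≤i)
                       (blk (toℕ i ∸ j) (subst (toℕ i ∸ j <_) (m+n∸m≡n j k) (∸-monoˡ-< i<j+k j≤i)))))
  where
  1≤n = ≤-trans (s≤s z≤n) k<n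
  n-1<n = n∸1<n 1≤n

true≢false : true ≢ false
true≢false ()

CBBF-intro : ∀ {n k} (T : Mat n) g → (∀ i → T i i ≡ g (toℕ i)) → IsSk n k g → CBBF n k T
CBBF-intro T g D =
  InS-fromIsSk {w = tabulate (λ i → T i i)} (describes λ i → trans (lookup∘tabulate (λ i → T i i) i) (D i))

CBBF-diagonal : ∀ {n k} (T : Mat n) → k < n → CBBF n k T → IsSk n k (diagonal T)
CBBF-diagonal T k<n =
  IsSk-fromInS {w = tabulate (λ i → T i i)} k<n
               (describes λ i → trans (lookup∘tabulate (λ i → T i i) i) (sym (entry-toℕ T i i)))

CBBF-resp : ∀ {n k} {T C : Mat n} → (∀ i j → T i j ≡ C i j) → CBBF n k C → CBBF n k T
CBBF-resp {n} {k} T≗C = subst (InS n k) (tabulate-cong (λ i → sym (T≗C i i)))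

PrefixIsSuffix : ℕ → ℕ → (ℕ → Bool) → (ℕ → Bool) → Set
PrefixIsSuffix n r u v = ∀ x → x < r → u x ≡ v (x + (n ∸ r))

-- With s = n - r the
-- prefix of u is placed at offset s in v: for r ≤ k, u's 1 at r-1 meets v's final 0;
-- for s ≤ k < r, u's 1 at k-s meets v's 0 at k; for s > k, u's leading 1^k becomes a
-- forbidden run of v at s.
S-overlap-free : ∀ {n k r u v} → 1 ≤ k → 1 ≤ r → r < n → IsSk n k u → IsSk n k v →
                 ¬ PrefixIsSuffix n r u v
S-overlap-free {n} {k} {r} {u} {v} 1≤k 1≤r r<n Su Sv pre with r ≤? k | n ∸ r ≤? k
... | yes r≤k | _ = true≢false (begin
  true                   ≡⟨ sym (IsSk.leading Su (r ∸ 1) (<-≤-trans (n∸1<n 1≤r) r≤k)) ⟩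
  u (r ∸ 1)              ≡⟨ pre (r ∸ 1) (n∸1<n 1≤r) ⟩
  v (r ∸ 1 + (n ∸ r))    ≡⟨ cong v (pred-offset 1≤r (<⇒≤ r<n)) ⟩
  v (n ∸ 1)              ≡⟨ IsSk.at-end Sv ⟩
  false                  ∎)
  where
  open ≡-Reasoning
  pred-offset : ∀ {r n} → 1 ≤ r → r ≤ n → r ∸ 1 + (n ∸ r) ≡ n ∸ 1
  pred-offset {suc _} _ r≤n = cong (_∸ 1) (m+[n∸m]≡n r≤n)
... | no r≰k | yes s≤k = true≢false (begin
  true                   ≡⟨ sym (IsSk.leading Su (k ∸ s) k-s<k) ⟩
  u (k ∸ s)              ≡⟨ pre (k ∸ s) (<-trans k-s<k (≰⇒> r≰k)) ⟩
  v (k ∸ s + s)          ≡⟨ cong v (m∸n+n≡m s≤k) ⟩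
  v k                    ≡⟨ IsSk.at-k Sv ⟩
  false                  ∎)
  where
  open ≡-Reasoning
  s = n ∸ r
  k-s<k : k ∸ s < k
  k-s<k = ∸-monoʳ-< {k} {s} {0} (m<n⇒0<n∸m r<n) s≤k
... | no r≰k | no s≰k = IsSk.no-run Sv (s , ≰⇒> s≰k , s+k≤n-1 , block)
  where
  s = n ∸ r
  k<r = ≰⇒> r≰k
  s+k≤n-1 : s + k ≤ n ∸ 1
  s+k≤n-1 = <⇒≤pred (<-≤-trans (+-monoʳ-< s k<r)
                                 (≤-reflexive (trans (+-comm s r) (m+[n∸m]≡n (<⇒≤ r<n)))))
  block : Block k v s
  block t t<k = trans (cong v (+-comm s t)) (trans (sym (pre t (<-trans t<k k<r))) (IsSk.leading Su t t<k))

PrefEqSuf-diagonal : ∀ {n r} (T T' : Mat n) → r < n → PrefEqSuf n r T T' →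
                     PrefixIsSuffix n r (diagonal T) (diagonal T')
PrefEqSuf-diagonal {n} {r} T T' r<n pes x x<r = begin
  entry T x x      ≡⟨ entry-< T x<n x<n ⟩
  T i i            ≡⟨ pes i i i' i' i<r i<r offset offset ⟩
  T' i' i'         ≡⟨ sym (entry-< T' y<n y<n) ⟩
  entry T' y y     ∎
  where
  open ≡-Reasoning
  x<n = <-trans x<r r<n
  y = x + (n ∸ r)
  y<n : y < n
  y<n = <-≤-trans (+-monoˡ-< (n ∸ r) x<r) (≤-reflexive (m+[n∸m]≡n (<⇒≤ r<n)))
  i = fromℕ< x<n
  i' = fromℕ< y<n
  i<r : toℕ i < r
  i<r = subst (_< r) (sym (toℕ-fromℕ< x<n)) x<r
  offset : toℕ i' ≡ toℕ i + (n ∸ r)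
  offset = trans (toℕ-fromℕ< y<n) (cong (_+ (n ∸ r)) (sym (toℕ-fromℕ< x<n)))

CBBF-no-PrefEqSuf : ∀ {n k r} (T T' : Mat n) → 1 ≤ k → k < n → CBBF n k T → CBBF n k T' →
                    1 ≤ r → r < n → ¬ PrefEqSuf n r T T'
CBBF-no-PrefEqSuf T T' 1≤k k<n cT cT' 1≤r r<n pes =
  S-overlap-free 1≤k 1≤r r<n (CBBF-diagonal T k<n cT) (CBBF-diagonal T' k<n cT')
                 (PrefEqSuf-diagonal T T' r<n pes)

CBBF-crossBBFSetOn : ∀ {n k} → 1 ≤ k → k < n → CrossBBFSetOn n (CBBF n k)
CBBF-crossBBFSetOn 1≤k k<n =
  (λ T cT r 1≤r r<n → CBBF-no-PrefEqSuf T T 1≤k k<n cT cT 1≤r r<n) ,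
  λ T T' cT cT' _ r 1≤r r<n →
    CBBF-no-PrefEqSuf T T' 1≤k k<n cT cT' 1≤r r<n , CBBF-no-PrefEqSuf T' T 1≤k k<n cT' cT 1≤r r<n

Overlap : ∀ n → Mat n → Mat n → Set
Overlap n T C = Σ ℕ λ r → 1 ≤ r × r < n × (PrefEqSuf n r T C ⊎ PrefEqSuf n r C T)

nonExpandable-by-overlap : ∀ {n} (P : Mat n → Set) →
  (∀ {T C} → (∀ i j → T i j ≡ C i j) → P C → P T) →
  (∀ T → BBF n T → ¬ P T → Σ (Mat n) λ C → P C × Overlap n T C) →
  NonExpandable n P
nonExpandable-by-overlap P resp overlapping T bbf ¬PT cross
  with C , PC , r , 1≤r , r<n , TC⊎CT ← overlapping T bbf ¬PT
  with ¬TC , ¬CT ← cross T C (inj₂ refl) (inj₁ PC) (λ T≗C → ¬PT (resp T≗C PC)) r 1≤r r<n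
  with TC⊎CT
... | inj₁ TC = ¬TC TC
... | inj₂ CT = ¬CT CT

PrefEqSuf-intro : ∀ {n r} (T C : Mat n) (F G : ℕ → ℕ → Bool) →
  (∀ i j → T i j ≡ F (toℕ i) (toℕ j)) → (∀ i j → C i j ≡ G (toℕ i) (toℕ j)) →
  (∀ x y → x < r → y < r → F x y ≡ G (x + (n ∸ r)) (y + (n ∸ r))) → PrefEqSuf n r T C
PrefEqSuf-intro T C F G T≗F C≗G F≡G i j i' j' i<r j<r i'≡ j'≡ =
  trans (T≗F i j) (trans (F≡G (toℕ i) (toℕ j) i<r j<r) (sym (trans (C≗G i' j') (cong₂ G i'≡ j'≡))))

cornerAt : ∀ {n} → Mat n → ℕ → ℕ → ℕ → ℕ → Bool
cornerAt T k s x y with s ≤? x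
... | yes _ = entry T (x ∸ s) (y ∸ s)
... | no _ = does (x <? k)

cornerAt-≥ : ∀ {n} (T : Mat n) k {s x} y → s ≤ x → cornerAt T k s x y ≡ entry T (x ∸ s) (y ∸ s)
cornerAt-≥ T k {s} {x} y s≤x with s ≤? x
... | yes _ = refl
... | no s≰x = contradiction s≤x s≰x

cornerAt-< : ∀ {n} (T : Mat n) k {s x} y → x < s → cornerAt T k s x y ≡ does (x <? k)
cornerAt-< T k {s} {x} y x<s with s ≤? x
... | yes s≤x = contradiction x<s (≤⇒≯ s≤x)
... | no _ = refl

-- The diagonal of cornerAt T k s lies in S_{n,2}^{(k)} when the corner starts beyond k,
-- is shorter than k (so it cannot contain a run) and T's diagonal is 0 at its end.
corner-IsSk : ∀ {n k s} (T : Mat n) → k < s → s ≤ n ∸ 1 → n ∸ 1 ∸ s < k →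
              diagonal T (n ∸ 1 ∸ s) ≡ false → IsSk n k (λ x → cornerAt T k s x x)
corner-IsSk {n} {k} {s} T k<s s≤n-1 short T-end = mkS
  (λ x x<k → trans (before (<-trans x<k k<s)) (dec-true (x <? k) x<k))
  (trans (before k<s) (dec-false (k <? k) (n≮n k)))
  (trans (cornerAt-≥ T k (n ∸ 1) s≤n-1) T-end)
  no-run
  where
  g : ℕ → Bool
  g x = cornerAt T k s x x
  before : ∀ {x} → x < s → g x ≡ does (x <? k)
  before = cornerAt-< T k _
  no-run : ¬ Run n k g
  no-run (j , k<j , j+k≤ , blk) with s ≤? j
  ... | no s≰j = true≢false (begin
    true                ≡⟨ sym (blk 0 (≤-<-trans z≤n short)) ⟩
    g (j + 0)           ≡⟨ cong g (+-identityʳ j) ⟩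
    g j                 ≡⟨ before (≰⇒> s≰j) ⟩
    does (j <? k)       ≡⟨ dec-false (j <? k) (<⇒≱ k<j ∘ <⇒≤) ⟩
    false               ∎)
    where open ≡-Reasoning
  ... | yes s≤j = <⇒≱ short (≤-trans (m+n≤o⇒m≤o∸n k (subst (_≤ n ∸ 1) (+-comm j k) j+k≤))
                                      (∸-monoʳ-≤ (n ∸ 1) s≤j))

-- Case of a 0 in the diagonal of T at a < k: T's (a+1)×(a+1) biprefix becomes the
-- bisuffix of a matrix whose diagonal starts with 1^k 0; as 2k+1 ≤ n the corner starts
-- beyond position k, so this matrix lies in CBBF n k.
corner-overlap : ∀ {n k a} (T : Mat n) → suc (k + k) ≤ n → a < k → diagonal T a ≡ false →
                 Σ (Mat n) λ C → CBBF n k C × Overlap n T C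
corner-overlap {n} {k} {a} T 2k<n a<k Taa =
  C , CBBF-intro C (λ x → cornerAt T k s x x) (λ _ → refl)
        (corner-IsSk T k<s (∸-monoʳ-≤ n (s≤s z≤n)) (subst (_< k) (sym end-offset) a<k)
                     (subst (λ z → diagonal T z ≡ false) (sym end-offset) Taa)) ,
  suc a , s≤s z≤n , r<n ,
  inj₁ (PrefEqSuf-intro T C (entry T) (cornerAt T k s) (entry-describes T) (λ _ _ → refl) placed)
  where
  s = n ∸ suc a
  C : Mat n
  C = matOf (cornerAt T k s)
  r<n : suc a < n
  r<n = ≤-<-trans a<k (<-≤-trans (m≤m+n (suc k) k) 2k<n)
  k<s : k < s
  k<s = m+n≤o⇒m≤o∸n (suc k) (≤-trans (+-monoʳ-≤ (suc k) a<k) 2k<n)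
  end-offset : n ∸ 1 ∸ s ≡ a
  end-offset = last-minus-offset (<⇒≤ r<n)
    where
    last-minus-offset : ∀ {m} → suc a ≤ m → m ∸ 1 ∸ (m ∸ suc a) ≡ a
    last-minus-offset {suc m} (s≤s a≤m) = m∸[m∸n]≡n a≤m
  placed : ∀ x y → x < suc a → y < suc a → entry T x y ≡ cornerAt T k s (x + s) (y + s)
  placed x y _ _ = sym (trans (cornerAt-≥ T k (y + s) (m≤n+m s x))
                              (cong₂ (entry T) (m+n∸n≡m x s) (m+n∸n≡m y s)))

-- In a bibifix-free matrix with T[0,0] = 1 the last diagonal entry is 0: otherwise
-- the 1×1 biprefix and bisuffix coincide.
BBF-last-diagonal : ∀ {n} (T : Mat n) → BBF n T → 1 < n → diagonal T 0 ≡ true →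
                    diagonal T (n ∸ 1) ≡ false
BBF-last-diagonal {n} T bbf 1<n T00 with diagonal T (n ∸ 1) in Tlast
... | false = refl
... | true = ⊥-elim (bbf 1 ≤-refl 1<n (PrefEqSuf-intro T T (entry T) (entry T)
                       (entry-describes T) (entry-describes T) corner))
  where
  corner : ∀ x y → x < 1 → y < 1 → entry T x y ≡ entry T (x + (n ∸ 1)) (y + (n ∸ 1))
  corner zero zero _ _ = trans T00 (sym Tlast)
  corner (suc _) _ (s≤s ()) _
  corner zero (suc _) _ (s≤s ())

EndsInZeros : ℕ → (ℕ → Bool) → Set
EndsInZeros n g = ∀ y → n ∸ 1 ≤ y → g y ≡ false

endsInZeros : ∀ {n g} → 1 ≤ n → g (n ∸ 1) ≡ false → (∀ y → n ≤ y → g y ≡ false) →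
              EndsInZeros n g
endsInZeros {n} 1≤n g-end beyond y n-1≤y with m≤n⇒m<n∨m≡n n-1≤y
... | inj₁ n-1<y = beyond y (subst (_≤ y) (suc-n∸1 1≤n) n-1<y)
... | inj₂ refl = g-end

data LargestUpTo (P : ℕ → Set) (B : ℕ) : Set where
  largest : ∀ j → 1 ≤ j → j ≤ B → P j → (∀ j' → j < j' → j' ≤ B → ¬ P j') → LargestUpTo P B
  none : (∀ j → 1 ≤ j → j ≤ B → ¬ P j) → LargestUpTo P B

largestUpTo : ∀ {P : ℕ → Set} → (∀ j → Dec (P j)) → ∀ B → LargestUpTo P B
largestUpTo P? zero = none λ j 1≤j j≤0 → contradiction (≤-trans 1≤j j≤0) λ ()
largestUpTo {P} P? (suc B) with P? (suc B)
... | yes P[1+B] = largest (suc B) (s≤s z≤n) ≤-refl P[1+B] λ j' j<j' j'≤ → contradiction j'≤ (<⇒≱ j<j')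
... | no ¬P[1+B] with largestUpTo P? B
...   | largest j 1≤j j≤B Pj above = largest j 1≤j (m≤n⇒m≤1+n j≤B) Pj above′
  where
  above′ : ∀ j' → j < j' → j' ≤ suc B → ¬ P j'
  above′ j' j<j' j'≤ with m≤n⇒m<n∨m≡n j'≤
  ... | inj₁ j'<1+B = above j' j<j' (s≤s⁻¹ j'<1+B)
  ... | inj₂ refl = ¬P[1+B]
...   | none nothing = none nothing′
  where
  nothing′ : ∀ j → 1 ≤ j → j ≤ suc B → ¬ P j
  nothing′ j 1≤j j≤ with m≤n⇒m<n∨m≡n j≤
  ... | inj₁ j<1+B = nothing j 1≤j (s≤s⁻¹ j<1+B)
  ... | inj₂ refl = ¬P[1+B]

block? : ∀ k g j → Dec (Block k g j)
block? k g j = map′ (λ all t → all {t}) (λ blk {t} → blk t) (allUpTo? (λ t → g (j + t) ≟ᵇ true) k)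

no-late-block : ∀ {n k g j} → 1 ≤ k → EndsInZeros n g → n ∸ 1 ∸ k < j →
                ¬ Block k g j
no-late-block {n} {suc k₀} {g} {j} _ zeros late blk =
  true≢false (trans (sym (blk k₀ ≤-refl)) (zeros (j + k₀) (s≤s⁻¹ n-1<)))
  where
  n-1< : n ∸ 1 < suc (j + k₀)
  n-1< = ≤-<-trans (m≤n+m∸n (n ∸ 1) (suc k₀))
           (subst (_< suc (j + k₀)) (+-comm (n ∸ 1 ∸ suc k₀) (suc k₀))
             (subst (n ∸ 1 ∸ suc k₀ + suc k₀ <_) (+-suc j k₀) (+-monoˡ-< (suc k₀) late)))

-- A word starting with 1^k, ending with 0 and without a block of k ones starting in
-- [1, n-1-k] lies in S_{n,2}^{(k)}: a 1 at position k would give a block at 1.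
blockFree-IsSk : ∀ {n k d} → k + 2 ≤ n → (∀ x → x < k → d x ≡ true) → d (n ∸ 1) ≡ false →
                 (∀ j → 1 ≤ j → j ≤ n ∸ 1 ∸ k → ¬ Block k d j) → IsSk n k d
blockFree-IsSk {n} {k} {d} k+2≤n ones d-end free = mkS ones d-k d-end no-run
  where
  d-k : d k ≡ false
  d-k with d k in dk
  ... | false = refl
  ... | true = ⊥-elim (free 1 ≤-refl 1≤n-1-k block-at-1)
    where
    1≤n-1-k : 1 ≤ n ∸ 1 ∸ k
    1≤n-1-k = subst (1 ≤_) (sym (∸-+-assoc n 1 k)) (m+n≤o⇒m≤o∸n 1 (subst (_≤ n) (+-comm k 2) k+2≤n))
    block-at-1 : Block k d 1
    block-at-1 t t<k with m≤n⇒m<n∨m≡n t<k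
    ... | inj₁ 1+t<k = ones (suc t) 1+t<k
    ... | inj₂ 1+t≡k = trans (cong d 1+t≡k) dk
  no-run : ¬ Run n k d
  no-run (j , k<j , j+k≤ , blk) = free j (≤-trans (s≤s z≤n) k<j) (m+n≤o⇒m≤o∸n j j+k≤) blk

shift-IsSk : ∀ {n k d j} → Block k d j → (∀ j' → j < j' → ¬ Block k d j') →
             EndsInZeros n d → IsSk n k (λ x → d (x + j))
shift-IsSk {n} {k} {d} {j} blk later zeros =
  mkS leading d-k (zeros (n ∸ 1 + j) (m≤m+n (n ∸ 1) j)) no-run
  where
  leading : ∀ x → x < k → d (x + j) ≡ true
  leading x x<k = trans (cong d (+-comm x j)) (blk x x<k)
  d-k : d (k + j) ≡ false
  d-k with d (k + j) in dk
  ... | false = refl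
  ... | true = ⊥-elim (later (suc j) ≤-refl next)
    where
    next : Block k d (suc j)
    next t t<k with m≤n⇒m<n∨m≡n t<k
    ... | inj₁ 1+t<k = trans (cong d (sym (+-suc j t))) (blk (suc t) 1+t<k)
    ... | inj₂ 1+t≡k = trans (cong d (trans (cong suc (+-comm j t)) (cong (_+ j) 1+t≡k))) dk
  no-run : ¬ Run n k (λ x → d (x + j))
  no-run (i , k<i , _ , run) = later (i + j) (m<n+m j (≤-<-trans z≤n k<i)) λ t t<k →
    trans (cong d (trans (+-assoc i j t) (trans (cong (i +_) (+-comm j t)) (sym (+-assoc i t j)))))
          (run t t<k)

shiftedBy : ∀ {n} → Mat n → ℕ → Mat n
shiftedBy T j = matOf (λ x y → entry T (x + j) (y + j))

shiftedBy-overlap : ∀ {n j} (T : Mat n) → 1 ≤ j → j < n → Overlap n T (shiftedBy T j)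
shiftedBy-overlap {n} {j} T 1≤j j<n =
  n ∸ j , m<n⇒0<n∸m j<n , ∸-monoʳ-< {n} {j} {0} 1≤j (<⇒≤ j<n) ,
  inj₂ (PrefEqSuf-intro (shiftedBy T j) T (λ x y → entry T (x + j) (y + j)) (entry T)
          (λ _ _ → refl) (entry-describes T)
          (λ x y _ _ → cong (λ o → entry T (x + o) (y + o)) (sym (m∸[m∸n]≡n (<⇒≤ j<n)))))

-- Case of a diagonal d starting with 1^k: since T ∉ CBBF n k, d has a block of k ones
-- starting in [1, n-1-k]; T shifted by the largest such start lies in CBBF n k.
leading-ones-overlap : ∀ {n k} (T : Mat n) → 1 ≤ k → k + 2 ≤ n → BBF n T → ¬ CBBF n k T →
                       (∀ x → x < k → diagonal T x ≡ true) →
                       Σ (Mat n) λ C → CBBF n k C × Overlap n T C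
leading-ones-overlap {n} {k} T 1≤k k+2≤n bbf ¬cT ones =
  case largestUpTo (block? k d) (n ∸ 1 ∸ k) of λ where
    (none free) → ⊥-elim (¬cT (CBBF-intro T d (λ i → entry-describes T i i)
                                 (blockFree-IsSk k+2≤n ones (zeros (n ∸ 1) ≤-refl) free)))
    (largest j 1≤j j≤B blk above) →
      let j<n = ≤-<-trans (≤-trans j≤B (m∸n≤m (n ∸ 1) k)) (n∸1<n (<⇒≤ 1<n)) in
      shiftedBy T j , CBBF-intro (shiftedBy T j) (λ x → d (x + j)) (λ _ → refl)
                        (shift-IsSk {n = n} blk (later j above) zeros) ,
      shiftedBy-overlap T 1≤j j<n
  where
  d = diagonal T
  1<n : 1 < n
  1<n = ≤-trans (m≤n+m 2 k) k+2≤n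
  zeros : EndsInZeros n d
  zeros = endsInZeros (<⇒≤ 1<n) (BBF-last-diagonal T bbf 1<n (ones 0 1≤k)) (λ _ → entry-≥ T)
  later : ∀ j → (∀ j' → j < j' → j' ≤ n ∸ 1 ∸ k → ¬ Block k d j') → ∀ j' → j < j' → ¬ Block k d j'
  later j above j' j<j' with j' ≤? n ∸ 1 ∸ k
  ... | yes j'≤B = above j' j<j' j'≤B
  ... | no j'≰B = no-late-block {n = n} 1≤k zeros (≰⇒> j'≰B)

CBBF-overlapping : ∀ {n k} → 1 ≤ k → suc (k + k) ≤ n → ∀ T → BBF n T → ¬ CBBF n k T →
                   Σ (Mat n) λ C → CBBF n k C × Overlap n T C
CBBF-overlapping {n} {k} 1≤k 2k<n T bbf ¬cT with anyUpTo? (λ x → diagonal T x ≟ᵇ false) k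
... | yes (a , a<k , Taa) = corner-overlap T 2k<n a<k Taa
... | no no-zero = leading-ones-overlap T 1≤k k+2≤n bbf ¬cT
                     (λ x x<k → ¬-not (λ Txx → no-zero (x , x<k , Txx)))
  where
  k+2≤n : k + 2 ≤ n
  k+2≤n = ≤-trans (subst (k + 2 ≤_) (+-suc k k) (+-monoʳ-≤ k (s≤s 1≤k))) 2k<n

CBBF-nonExpandable : ∀ {n k} → 1 ≤ k → suc (k + k) ≤ n → NonExpandable n (CBBF n k)
CBBF-nonExpandable 1≤k 2k<n = nonExpandable-by-overlap _ CBBF-resp (CBBF-overlapping 1≤k 2k<n)

allWords : ∀ n → List (Word n)
allWords zero = Vec.[] ∷ []
allWords (suc n) = map (true Vec.∷_) (allWords n) ++ map (false Vec.∷_) (allWords n)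

allWords-complete : ∀ {n} (w : Word n) → w ∈ allWords n
allWords-complete Vec.[] = here refl
allWords-complete (true Vec.∷ w) = ∈-++⁺ˡ (∈-map⁺ (true Vec.∷_) (allWords-complete w))
allWords-complete {suc n} (false Vec.∷ w) =
  ∈-++⁺ʳ (map (true Vec.∷_) (allWords n)) (∈-map⁺ (false Vec.∷_) (allWords-complete w))

allWords-unique : ∀ n → Unique (allWords n)
allWords-unique zero = All.[] ∷ []
allWords-unique (suc n) =
  Unique.++⁺ (Unique.map⁺ ∷-injectiveʳ (allWords-unique n)) (Unique.map⁺ ∷-injectiveʳ (allWords-unique n))
             disjoint
  where
  disjoint : ∀ {w} → ¬ (w ∈ map (true Vec.∷_) (allWords n) × w ∈ map (false Vec.∷_) (allWords n))
  disjoint (p , q) with ∈-map⁻ (true Vec.∷_) p | ∈-map⁻ (false Vec.∷_) q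
  ... | _ , _ , refl | _ , _ , ()

-- Membership in S_{n,2}^{(k)} is decidable; a run may only start below n.
HasRun? : ∀ n k (w : Word n) → Dec (HasRun n k w)
HasRun? n k w = map′ (λ (j , _ , run) → j , run) (λ (j , run) → j , start<1+n (proj₁ (proj₂ run)) , run)
                     (anyUpTo? (λ j → (suc k ≤? j) ×-dec ((j + k ≤? n ∸ 1) ×-dec all? λ i →
                        (j ≤? toℕ i) →-dec ((toℕ i <? j + k) →-dec (lookup w i ≟ᵇ true)))) (suc n))
  where
  start<1+n : ∀ {j} → j + k ≤ n ∸ 1 → j < suc n
  start<1+n j+k≤ = s≤s (≤-trans (m+n≤o⇒m≤o _ j+k≤) (m∸n≤m n 1))

InS? : ∀ n k (w : Word n) → Dec (InS n k w)
InS? n k w =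
  all? (λ i → (toℕ i <? k) →-dec (lookup w i ≟ᵇ true)) ×-dec
  (all? (λ i → (toℕ i ≟ k) →-dec (lookup w i ≟ᵇ false)) ×-dec
  (all? (λ i → (suc (toℕ i) ≟ n) →-dec (lookup w i ≟ᵇ false)) ×-dec
  ¬? (HasRun? n k w)))

S-card : ∀ n k → Σ ℕ (HasCard (InS n k))
S-card n k = length S , S , Unique.filter⁺ (InS? n k) (allWords-unique n) ,
             (λ w → mk⇔ (proj₂ ∘ ∈-filter⁻ (InS? n k) {xs = allWords n}) (∈-filter⁺ (InS? n k) (allWords-complete w))) ,
             refl
  where
  S = filter (InS? n k) (allWords n)

∈-─ : ∀ {A : Set} {x y : A} {ys} (x∈ys : x ∈ ys) → y ∈ ys → y ≢ x → y ∈ (ys ─ x∈ys)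
∈-─ (here refl) (here refl) y≢x = contradiction refl y≢x
∈-─ (here _) (there y∈ys) _ = y∈ys
∈-─ (there _) (here y≡) _ = here y≡
∈-─ (there x∈ys) (there y∈ys) y≢x = there (∈-─ x∈ys y∈ys y≢x)

unique-⊆-length : ∀ {A : Set} {xs ys : List A} → Unique xs → (∀ {x} → x ∈ xs → x ∈ ys) →
                  length xs ≤ length ys
unique-⊆-length {xs = []} _ _ = z≤n
unique-⊆-length {xs = x ∷ xs} {ys} (x∉xs ∷ xs!) xs⊆ys =
  subst (suc (length xs) ≤_) (sym (length-removeAt′ ys (index x∈ys)))
        (s≤s (unique-⊆-length xs! λ y∈xs →
           ∈-─ x∈ys (xs⊆ys (there y∈xs)) (λ y≡x → All.lookup x∉xs y∈xs (sym y≡x))))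
  where
  x∈ys = xs⊆ys (here refl)

map-unique : ∀ {A B : Set} {f : A → B} {xs} → Unique xs →
             (∀ {x y} → x ∈ xs → y ∈ xs → f x ≡ f y → x ≡ y) → Unique (map f xs)
map-unique {xs = []} [] _ = []
map-unique {xs = x ∷ xs} (x∉xs ∷ xs!) inj =
  All.map⁺ (All.tabulate λ y∈xs fx≡fy → All.lookup x∉xs y∈xs (inj (here refl) (there y∈xs) fx≡fy)) ∷
  map-unique xs! (λ x∈ y∈ → inj (there x∈) (there y∈))

card-< : ∀ {n} {P Q : Word n → Set} {N M} → HasCard P N → HasCard Q M →
         (f : Word n → Word n) → (∀ {w} → P w → Q (f w)) →
         (∀ {w w'} → P w → P w' → f w ≡ f w' → w ≡ w') →
         (z : Word n) → Q z → (∀ {w} → P w → z ≢ f w) → N < M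
card-< {P = P} {Q} (l , l! , ∈l⇔P , refl) (l' , _ , ∈l'⇔Q , refl) f P⇒Q inj z Qz z-new =
  subst (_≤ length l') (cong suc (length-map f l)) (unique-⊆-length (z∉ ∷ map-unique l! inj′) ⊆l')
  where
  inP : ∀ {w} → w ∈ l → P w
  inP {w} = Equivalence.to (∈l⇔P w)
  inj′ : ∀ {w w'} → w ∈ l → w' ∈ l → f w ≡ f w' → w ≡ w'
  inj′ w∈ w'∈ = inj (inP w∈) (inP w'∈)
  z∉ = All.map⁺ (All.tabulate (z-new ∘ inP))
  ⊆l' : ∀ {v} → v ∈ z ∷ map f l → v ∈ l'
  ⊆l' (here refl) = Equivalence.from (∈l'⇔Q z) Qz
  ⊆l' (there v∈) with ∈-map⁻ f v∈
  ... | w , w∈ , refl = Equivalence.from (∈l'⇔Q (f w)) (P⇒Q (inP w∈))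

-- Letter of a word at a natural position; positions beyond the end read as 0.
wordAt : ∀ {n} → Word n → ℕ → Bool
wordAt {n} w x with x <? n
... | yes x<n = lookup w (fromℕ< x<n)
... | no _ = false

wordAt-< : ∀ {n} (w : Word n) {x} (x<n : x < n) → wordAt w x ≡ lookup w (fromℕ< x<n)
wordAt-< {n} w {x} x<n with x <? n
... | yes _ = refl
... | no x≮n = contradiction x<n x≮n

wordAt-≥ : ∀ {n} (w : Word n) {x} → n ≤ x → wordAt w x ≡ false
wordAt-≥ {n} w {x} n≤x with x <? n
... | yes x<n = contradiction x<n (≤⇒≯ n≤x)
... | no _ = refl

wordAt-toℕ : ∀ {n} (w : Word n) i → wordAt w (toℕ i) ≡ lookup w i
wordAt-toℕ w i = trans (wordAt-< w (toℕ<n i)) (cong (lookup w) (fromℕ<-toℕ i (toℕ<n i)))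

wordAt-describes : ∀ {n} (w : Word n) → Describes w (wordAt w)
wordAt-describes w = describes (sym ∘ wordAt-toℕ w)

wordOf : ∀ {n} → (ℕ → Bool) → Word n
wordOf g = tabulate (g ∘ toℕ)

wordOf-describes : ∀ {n} (g : ℕ → Bool) → Describes (wordOf {n} g) g
wordOf-describes g = describes (lookup∘tabulate (g ∘ toℕ))

wordAt-wordOf : ∀ {n} (g : ℕ → Bool) {x} → x < n → wordAt (wordOf {n} g) x ≡ g x
wordAt-wordOf g x<n = trans (wordAt-< (wordOf g) x<n) (sym (describes-< (wordOf-describes g) x<n))

word-ext : ∀ {n} (w w' : Word n) → (∀ x → x < n → wordAt w x ≡ wordAt w' x) → w ≡ w'
word-ext w w' w≗w' = begin
  w                        ≡⟨ sym (tabulate∘lookup w) ⟩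
  tabulate (lookup w)      ≡⟨ tabulate-cong (λ i → trans (sym (wordAt-toℕ w i))
                                (trans (w≗w' (toℕ i) (toℕ<n i)) (wordAt-toℕ w' i))) ⟩
  tabulate (lookup w')     ≡⟨ tabulate∘lookup w' ⟩
  w'                       ∎
  where open ≡-Reasoning

-- The word with its first letter removed (and a 0 appended).
dropFirst : ∀ {n} → Word n → Word n
dropFirst w = wordOf (wordAt w ∘ suc)

-- Dropping the first letter maps S^{(k+1)} into S^{(k)} when k ≥ 1 and n ≤ 2k+2: a run of
-- k ones from position j ≥ k+1 would reach position j+k ≥ n-1 of the original word.
drop-IsSk : ∀ {n k g} → 1 ≤ k → n ≤ suc k + suc k → EndsInZeros n g → IsSk n (suc k) g →
            IsSk n k (g ∘ suc)
drop-IsSk {n} {suc k₀} {g} _ n≤ zeros (mkS leading at-k _ _) =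
  mkS (λ x x<k → leading (suc x) (s≤s x<k)) at-k (zeros (suc (n ∸ 1)) (n≤1+n (n ∸ 1))) no-run
  where
  no-run : ¬ Run n (suc k₀) (g ∘ suc)
  no-run (j , k<j , _ , blk) = true≢false (trans (sym (blk k₀ ≤-refl)) (zeros (suc (j + k₀)) n-1≤))
    where
    n-1≤ : n ∸ 1 ≤ suc (j + k₀)
    n-1≤ = ≤-trans (∸-monoˡ-≤ 1 n≤)
                   (s≤s (subst (_≤ j + k₀) (+-comm (suc (suc k₀)) k₀) (+-monoˡ-≤ k₀ k<j)))

-- The word 1^k 0…0 1 0 of length m+2, whose 1 at position m is isolated.
spike : ℕ → ℕ → ℕ → Bool
spike m k x = does (x <? k) ∨ does (x ≟ m)

spike-at-m : ∀ m k → spike m k m ≡ true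
spike-at-m m k = trans (cong (does (m <? k) ∨_) (dec-true (m ≟ m) refl)) (∨-zeroʳ _)

spike-beyond-k : ∀ {m k x} → k ≤ x → spike m k x ≡ true → x ≡ m
spike-beyond-k {m} {k} {x} k≤x spike≡true with x ≟ m
... | yes x≡m = x≡m
... | no x≢m = contradiction (trans (sym spike≡true)
                 (cong₂ _∨_ (dec-false (x <? k) (≤⇒≯ k≤x)) (dec-false (x ≟ m) x≢m))) λ ()

-- For 2 ≤ k < m the spike lies in S_{m+2,2}^{(k)}: a run has at least two ones beyond k.
spike-IsSk : ∀ {m k} → 2 ≤ k → k < m → IsSk (suc (suc m)) k (spike m k)
spike-IsSk {m} {k} 2≤k k<m = mkS
  (λ x x<k → cong (_∨ does (x ≟ m)) (dec-true (x <? k) x<k))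
  (cong₂ _∨_ (dec-false (k <? k) (n≮n k)) (dec-false (k ≟ m) (<⇒≢ k<m)))
  (cong₂ _∨_ (dec-false (suc m <? k) (<⇒≯ (<-trans k<m (n<1+n m)))) (dec-false (suc m ≟ m) (≢-sym (<⇒≢ (n<1+n m)))))
  λ (j , k<j , _ , blk) →
    let j≤ = ≤-trans (n≤1+n k) k<j
        at-j = spike-beyond-k (subst (k ≤_) (sym (+-identityʳ j)) j≤) (blk 0 (≤-trans (s≤s z≤n) 2≤k))
        at-j+1 = spike-beyond-k (≤-trans j≤ (m≤m+n j 1)) (blk 1 2≤k)
    in contradiction (+-cancelˡ-≡ j 1 0 (trans at-j+1 (sym at-j))) λ ()

-- For 2 ≤ k < m and m ≤ 2k, i.e. n = m+2 ≤ 2k+2:  |S_{n,2}^{(k+1)}| < |S_{n,2}^{(k)}|, since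
-- dropFirst maps S^{(k+1)} injectively into S^{(k)} and misses the spike.
S-card-decreasing : ∀ {m k N N'} → 2 ≤ k → k < m → m ≤ k + k →
  HasCard (InS (suc (suc m)) (suc k)) N → HasCard (InS (suc (suc m)) k) N' → N < N'
S-card-decreasing {m} {k} 2≤k k<m m≤2k card card' =
  card-< card card' dropFirst drop-in drop-injective (wordOf (spike m k))
         (InS-fromIsSk (wordOf-describes (spike m k)) (spike-IsSk 2≤k k<m)) spike-missed
  where
  n = suc (suc m)
  IsSk-of : ∀ {w : Word n} → InS n (suc k) w → IsSk n (suc k) (wordAt w)
  IsSk-of {w} = IsSk-fromInS {w = w} (s≤s (s≤s (<⇒≤ k<m))) (wordAt-describes w)
  drop-in : ∀ {w : Word n} → InS n (suc k) w → InS n k (dropFirst w)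
  drop-in {w} Sw = InS-fromIsSk (wordOf-describes (wordAt w ∘ suc))
    (drop-IsSk (≤-trans (s≤s z≤n) 2≤k) (s≤s (subst (suc m ≤_) (sym (+-suc k k)) (s≤s m≤2k)))
               (endsInZeros (s≤s z≤n) (IsSk.at-end (IsSk-of {w} Sw)) (λ _ → wordAt-≥ w)) (IsSk-of {w} Sw))
  drop-injective : ∀ {w w'} → InS n (suc k) w → InS n (suc k) w' → dropFirst w ≡ dropFirst w' → w ≡ w'
  drop-injective {w} {w'} Sw Sw' eq = word-ext w w' λ where
    zero _ → trans (IsSk.leading (IsSk-of {w} Sw) 0 (s≤s z≤n)) (sym (IsSk.leading (IsSk-of {w'} Sw') 0 (s≤s z≤n)))
    (suc y) 1+y<n → let y<n : y < n
                        y<n = <-trans (n<1+n y) 1+y<n in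
      trans (sym (wordAt-wordOf (wordAt w ∘ suc) y<n))
            (trans (cong (λ v → wordAt v y) eq) (wordAt-wordOf (wordAt w' ∘ suc) y<n))
  spike-missed : ∀ {w} → InS n (suc k) w → wordOf (spike m k) ≢ dropFirst w
  spike-missed {w} Sw eq = true≢false (begin
    true                           ≡⟨ sym (spike-at-m m k) ⟩
    spike m k m                    ≡⟨ sym (wordAt-wordOf (spike m k) m<n) ⟩
    wordAt (wordOf {n} (spike m k)) m  ≡⟨ cong (λ v → wordAt v m) eq ⟩
    wordAt (dropFirst w) m         ≡⟨ wordAt-wordOf (wordAt w ∘ suc) m<n ⟩
    wordAt w (suc m)               ≡⟨ IsSk.at-end (IsSk-of {w} Sw) ⟩
    false                          ∎)
    where
    open ≡-Reasoning
    m<n : m < n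
    m<n = ≤-trans (n≤1+n (suc m)) ≤-refl

not-maximal : ∀ {m k} → 2 ≤ k → k < m → m ≤ k + k → ¬ IsMaxK (suc (suc m)) (suc k)
not-maximal {m} {k} 2≤k k<m m≤2k maxK with S-card (suc (suc m)) (suc k) | S-card (suc (suc m)) k
... | N , card | N' , card' =
  <⇒≱ (S-card-decreasing 2≤k k<m m≤2k card card') (maxK k N' N (≤-trans (s≤s z≤n) 2≤k) (<⇒≤ k<m) card' card)

-- A k maximising |S_{n,2}^{(k)}| satisfies 2k+1 ≤ n: for k = 1 this is n ≥ 3, k = 2 with
-- n ≤ 4 forces the excluded case n = 4, and k ≥ 3 with n ≤ 2k is ruled out by not-maximal.
maximal-k-bound : ∀ {n k} → 3 ≤ n → k ≤ n ∸ 2 → IsMaxK n k → (n ≡ 4 → k ≡ 1) →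
                  suc (k + k) ≤ n
maximal-k-bound {suc zero} (s≤s ()) _ _ _
maximal-k-bound {suc (suc m)} {k} 3≤n k≤m maxK n≡4⇒k≡1 with suc (k + k) ≤? suc (suc m)
... | yes 2k<n = 2k<n
... | no 2k≮n = ⊥-elim (too-large k refl 3≤n k≤m (≮⇒≥ 2k≮n))
  where
  too-large : ∀ k′ → k′ ≡ k → 3 ≤ suc (suc m) → k′ ≤ m → suc (suc m) ≤ k′ + k′ → ⊥
  too-large 1 _ 3≤n _ n≤2 = contradiction (≤-trans 3≤n n≤2) λ { (s≤s (s≤s ())) }
  too-large 2 refl _ 2≤m (s≤s (s≤s m≤2)) = contradiction (n≡4⇒k≡1 (cong (suc ∘ suc) (≤-antisym m≤2 2≤m))) λ ()
  too-large (suc (suc (suc k₀))) refl _ k≤m n≤2k =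
    not-maximal (s≤s (s≤s z≤n)) k≤m (s≤s⁻¹ (subst (suc m ≤_) (+-suc k′ k′) (s≤s⁻¹ n≤2k))) maxK
    where k′ = suc (suc k₀)

proposition4p1 : ∀ (n k : ℕ) → 3 ≤ n → 1 ≤ k → k ≤ n ∸ 2 →
    IsMaxK n k → (n ≡ 4 → k ≡ 1) →
    CrossBBFSetOn n (CBBF n k) × NonExpandable n (CBBF n k)
proposition4p1 n k 3≤n 1≤k k≤n-2 maxK n≡4⇒k≡1 =
  CBBF-crossBBFSetOn 1≤k k<n , CBBF-nonExpandable 1≤k 2k<n
  where
  2k<n : suc (k + k) ≤ n
  2k<n = maximal-k-bound 3≤n k≤n-2 maxK n≡4⇒k≡1
  k<n : k < n
  k<n = <-≤-trans (m≤m+n (suc k) k) 2k<n
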